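{- For integers $2\leq m\leq n$, the complete bipartite graph $K_{m,n}$ satisfies $tpc(K_{m,n})=3$.
   Context: All graphs are simple, finite and undirected. A graph is total-colored if every vertex and every edge receives a color. A path $v_1v_2\ldots v_s$ in a total-colored graph is a total proper path if (i) any two adjacent edges on the path have different colors, (ii) any two adjacent internal vertices of the path (vertices among $v_2,\ldots,v_{s-1}$) have different colors, and (iii) every internal vertex of the path has a color different from the colors of its two incident edges on the path. A total-colored graph is total proper connected if every two vertices are joined by a total proper path. For a connected graph $G$, the total proper connection number $tpc(G)$ is the smallest number of colors in a total-coloring making $G$ total proper connected. -}

module Defs where

open import Data.Nat using (ℕ; _<_)
open import Data.Fin using (Fin)
open import Data.Sum using (_⊎_; inj₁; inj₂)
open import Data.Product using (Σ; ∃; _×_)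
open import Data.Unit using (⊤)
open import Data.Empty using (⊥)
open import Data.List using (List; []; _∷_; _++_; [_])
open import Data.List.Relation.Unary.Unique.Propositional using (Unique)
open import Relation.Nullary using (¬_)
open import Relation.Binary.PropositionalEquality using (_≡_; _≢_)

record Graph : Set₁ where
  field
    V      : Set
    Adj    : V → V → Set
    symAdj : ∀ {u v} → Adj u v → Adj v u
    irrAdj : ∀ {v} → ¬ Adj v v

-- Edge colors are given by a symmetric function on vertex pairs
-- (its values on non-adjacent pairs are irrelevant).
record TotalColoring (G : Graph) (C : Set) : Set where
  open Graph G
  field
    vcol    : V → C
    ecol    : V → V → C
    ecolSym : ∀ u v → ecol u v ≡ ecol v u

module _ {G : Graph} {C : Set} (c : TotalColoring G C) where
  open Graph G
  open TotalColoring c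

  Chain : List V → Set
  Chain []              = ⊤
  Chain (x ∷ [])        = ⊤
  Chain (x ∷ y ∷ r)     = Adj x y × Chain (y ∷ r)

  TripleCond : List V → Set
  TripleCond (x ∷ y ∷ z ∷ r) =
    (ecol x y ≢ ecol y z) × (vcol y ≢ ecol x y) × (vcol y ≢ ecol y z)
      × TripleCond (y ∷ z ∷ r)
  TripleCond _ = ⊤

  QuadCond : List V → Set
  QuadCond (w ∷ x ∷ y ∷ z ∷ r) = (vcol x ≢ vcol y) × QuadCond (x ∷ y ∷ z ∷ r)
  QuadCond _ = ⊤

  TotalProperPath : List V → Set
  TotalProperPath p = Chain p × Unique p × TripleCond p × QuadCond p

  TotalProperConnected : Set
  TotalProperConnected =
    ∀ u v → u ≢ v → ∃ λ (ys : List V) → TotalProperPath (u ∷ ys ++ [ v ])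

HasTPC : Graph → ℕ → Set
HasTPC G k = Σ (TotalColoring G (Fin k)) TotalProperConnected

TPCNumber : Graph → ℕ → Set
TPCNumber G k = HasTPC G k × (∀ j → j < k → ¬ HasTPC G j)

KAdj : ∀ {m n} → Fin m ⊎ Fin n → Fin m ⊎ Fin n → Set
KAdj (inj₁ _) (inj₂ _) = ⊤
KAdj (inj₂ _) (inj₁ _) = ⊤
KAdj _ _ = ⊥

KSym : ∀ {m n} {u v : Fin m ⊎ Fin n} → KAdj u v → KAdj v u
KSym {u = inj₁ _} {inj₂ _} _ = _
KSym {u = inj₂ _} {inj₁ _} _ = _

KIrr : ∀ {m n} {v : Fin m ⊎ Fin n} → ¬ KAdj v v
KIrr {v = inj₁ _} ()
KIrr {v = inj₂ _} ()

K : ℕ → ℕ → Graph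
K m n = record { V = Fin m ⊎ Fin n ; Adj = KAdj ; symAdj = KSym ; irrAdj = KIrr }

module Submission where

-- Two non-adjacent vertices (two vertices of the same side of K_{m,n})
-- can only be joined by a path with an internal vertex y, and at y the
-- colours of the two path edges and of y itself are pairwise distinct;
-- so at least three colours are needed.  Three suffice: distinguish
-- hubs a₀ and b₀ on the two sides.  Every pair on one side is joined
-- through a single vertex of the other side, except pairs in A ∖ {a₀}
-- not involving a₁ and pairs in B ∖ {b₀}, which take a detour of length
-- four through both hubs.

open import Defs
open import Data.Nat using (ℕ; suc; _≤_; s≤s; z≤n)
open import Data.Nat.Properties using (≤-trans; <⇒≱)
open import Data.Fin using (Fin; zero; suc; #_)
open import Data.Sum using (_⊎_; inj₁; inj₂)
open import Data.Product using (∃₂; _×_; _,_)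
open import Data.Unit using (tt)
open import Data.List using ([]; _∷_; _++_; [_])
open import Data.List.Relation.Unary.All using ([]; _∷_)
open import Data.List.Relation.Unary.AllPairs using ([]; _∷_)
open import Function using (_∘_)
open import Relation.Nullary using (¬_; contradiction)
open import Relation.Binary.PropositionalEquality using (_≡_; _≢_; refl; ≢-sym)

distinct₃⇒3≤ : ∀ {j} {a b c : Fin j} → a ≢ b → a ≢ c → b ≢ c → 3 ≤ j
distinct₃⇒3≤ {suc (suc (suc _))} _ _ _ = s≤s (s≤s (s≤s z≤n))
distinct₃⇒3≤ {1} {zero} {zero} a≢b _ _ = contradiction refl a≢b
distinct₃⇒3≤ {2} {zero} {zero} a≢b _ _ = contradiction refl a≢b
distinct₃⇒3≤ {2} {suc zero} {suc zero} a≢b _ _ = contradiction refl a≢b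
distinct₃⇒3≤ {2} {zero} {suc zero} {zero} _ a≢c _ = contradiction refl a≢c
distinct₃⇒3≤ {2} {suc zero} {zero} {suc zero} _ a≢c _ = contradiction refl a≢c
distinct₃⇒3≤ {2} {zero} {suc zero} {suc zero} _ _ b≢c = contradiction refl b≢c
distinct₃⇒3≤ {2} {suc zero} {zero} {zero} _ _ b≢c = contradiction refl b≢c

module TotalProperPaths {G : Graph} {C : Set} (c : TotalColoring G C) where
  open Graph G
  open TotalColoring c

  ProperTurn : V → V → V → Set
  ProperTurn x y z = ecol x y ≢ ecol y z × vcol y ≢ ecol x y × vcol y ≢ ecol y z

  adjacent⇒≢ : ∀ {u v} → Adj u v → u ≢ v
  adjacent⇒≢ uv refl = irrAdj uv

  totalProperPath₁ : ∀ {u v} → Adj u v → TotalProperPath c (u ∷ v ∷ [])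
  totalProperPath₁ uv = (uv , tt) , (adjacent⇒≢ uv ∷ []) ∷ [] ∷ [] , tt , tt

  totalProperPath₂ : ∀ {u x v} → Adj u x → Adj x v → u ≢ v → ProperTurn u x v →
                     TotalProperPath c (u ∷ x ∷ v ∷ [])
  totalProperPath₂ ux xv u≢v (t₁ , t₂ , t₃) =
    (ux , xv , tt) ,
    (adjacent⇒≢ ux ∷ u≢v ∷ []) ∷ (adjacent⇒≢ xv ∷ []) ∷ [] ∷ [] ,
    (t₁ , t₂ , t₃ , tt) , tt

  totalProperPath₄ : ∀ {u x y z v} →
                     Adj u x → Adj x y → Adj y z → Adj z v →
                     u ≢ y → u ≢ z → u ≢ v → x ≢ z → x ≢ v → y ≢ v →
                     ProperTurn u x y → ProperTurn x y z → ProperTurn y z v →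
                     vcol x ≢ vcol y → vcol y ≢ vcol z →
                     TotalProperPath c (u ∷ x ∷ y ∷ z ∷ v ∷ [])
  totalProperPath₄ ux xy yz zv u≢y u≢z u≢v x≢z x≢v y≢v
                   (t₁ , t₂ , t₃) (t₄ , t₅ , t₆) (t₇ , t₈ , t₉) vx≢vy vy≢vz =
    (ux , xy , yz , zv , tt) ,
    (adjacent⇒≢ ux ∷ u≢y ∷ u≢z ∷ u≢v ∷ []) ∷ (adjacent⇒≢ xy ∷ x≢z ∷ x≢v ∷ []) ∷
      (adjacent⇒≢ yz ∷ y≢v ∷ []) ∷ (adjacent⇒≢ zv ∷ []) ∷ [] ∷ [] ,
    (t₁ , t₂ , t₃ , t₄ , t₅ , t₆ , t₇ , t₈ , t₉ , tt) ,
    (vx≢vy , vy≢vz , tt)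

  nonadjacent-internalTurn : ∀ {u v} ys → ¬ Adj u v →
                             TotalProperPath c (u ∷ ys ++ [ v ]) →
                             ∃₂ λ y z → ProperTurn u y z
  nonadjacent-internalTurn []          ¬uv ((uv , _) , _) = contradiction uv ¬uv
  nonadjacent-internalTurn (y ∷ [])    _   (_ , _ , (t₁ , t₂ , t₃ , _) , _) = y , _ , t₁ , t₂ , t₃
  nonadjacent-internalTurn (y ∷ z ∷ _) _   (_ , _ , (t₁ , t₂ , t₃ , _) , _) = y , z , t₁ , t₂ , t₃

hasTPC⇒3≤ : ∀ {G j} {u v : Graph.V G} → u ≢ v → ¬ Graph.Adj G u v → HasTPC G j → 3 ≤ j
hasTPC⇒3≤ u≢v ¬uv (c , connected)
  with ys , path ← connected _ _ u≢v
  with _ , _ , t₁ , t₂ , t₃ ← TotalProperPaths.nonadjacent-internalTurn c ys ¬uv path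
  = distinct₃⇒3≤ t₁ (≢-sym t₂) (≢-sym t₃)

pattern a₀ = inj₁ zero
pattern a₁ = inj₁ (suc zero)
pattern a₊ i = inj₁ (suc (suc i))
pattern b₀ = inj₂ zero
pattern b₁ = inj₂ (suc zero)

module HubColouring (m n : ℕ) where
  Vertex : Set
  Vertex = Fin (suc (suc m)) ⊎ Fin (suc (suc n))

  vertexColour : Vertex → Fin 3
  vertexColour a₀ = # 0
  vertexColour b₀ = # 1
  vertexColour _  = # 2

  -- The clause order makes edgeColour (suc i) zero reduce for a variable i,
  -- which lets a₁ and a₊ i share the clauses of `connected` involving a₀.
  edgeColour : Fin (suc (suc m)) → Fin (suc (suc n)) → Fin 3
  edgeColour zero          zero    = # 2
  edgeColour zero          (suc _) = # 1
  edgeColour (suc _)       zero    = # 0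
  edgeColour (suc zero)    (suc _) = # 1
  edgeColour (suc (suc _)) (suc _) = # 0

  colour : Vertex → Vertex → Fin 3
  colour (inj₁ a) (inj₂ b) = edgeColour a b
  colour (inj₂ b) (inj₁ a) = edgeColour a b
  colour _        _        = # 0

  colour-sym : ∀ u v → colour u v ≡ colour v u
  colour-sym (inj₁ _) (inj₁ _) = refl
  colour-sym (inj₁ _) (inj₂ _) = refl
  colour-sym (inj₂ _) (inj₁ _) = refl
  colour-sym (inj₂ _) (inj₂ _) = refl

  colouring : TotalColoring (K (suc (suc m)) (suc (suc n))) (Fin 3)
  colouring = record { vcol = vertexColour ; ecol = colour ; ecolSym = colour-sym }

  open TotalProperPaths colouring

  connected : TotalProperConnected colouring
  connected (inj₁ _) (inj₂ _) _ = [] , totalProperPath₁ tt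
  connected (inj₂ _) (inj₁ _) _ = [] , totalProperPath₁ tt
  connected a₀ a₀ a₀≢a₀ = contradiction refl a₀≢a₀
  connected a₀ (inj₁ (suc _)) _ =
    [ b₀ ] , totalProperPath₂ tt tt (λ ()) ((λ ()) , (λ ()) , (λ ()))
  connected (inj₁ (suc _)) a₀ _ =
    [ b₀ ] , totalProperPath₂ tt tt (λ ()) ((λ ()) , (λ ()) , (λ ()))
  connected a₁ a₁ a₁≢a₁ = contradiction refl a₁≢a₁
  connected a₁ (a₊ _) _ =
    [ b₁ ] , totalProperPath₂ tt tt (λ ()) ((λ ()) , (λ ()) , (λ ()))
  connected (a₊ _) a₁ _ =
    [ b₁ ] , totalProperPath₂ tt tt (λ ()) ((λ ()) , (λ ()) , (λ ()))
  connected (a₊ _) (a₊ _) u≢v =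
    b₀ ∷ a₀ ∷ b₁ ∷ [] ,
    totalProperPath₄ tt tt tt tt (λ ()) (λ ()) u≢v (λ ()) (λ ()) (λ ())
      ((λ ()) , (λ ()) , (λ ())) ((λ ()) , (λ ()) , (λ ())) ((λ ()) , (λ ()) , (λ ()))
      (λ ()) (λ ())
  connected b₀ b₀ b₀≢b₀ = contradiction refl b₀≢b₀
  connected b₀ (inj₂ (suc _)) _ =
    [ a₀ ] , totalProperPath₂ tt tt (λ ()) ((λ ()) , (λ ()) , (λ ()))
  connected (inj₂ (suc _)) b₀ _ =
    [ a₀ ] , totalProperPath₂ tt tt (λ ()) ((λ ()) , (λ ()) , (λ ()))
  connected (inj₂ (suc _)) (inj₂ (suc _)) u≢v =
    a₀ ∷ b₀ ∷ a₁ ∷ [] ,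
    totalProperPath₄ tt tt tt tt (λ ()) (λ ()) u≢v (λ ()) (λ ()) (λ ())
      ((λ ()) , (λ ()) , (λ ())) ((λ ()) , (λ ()) , (λ ())) ((λ ()) , (λ ()) , (λ ()))
      (λ ()) (λ ())

K-hasTPC₃ : ∀ {m n} → 2 ≤ m → 2 ≤ n → HasTPC (K m n) 3
K-hasTPC₃ {suc (suc m)} {suc (suc n)} (s≤s (s≤s _)) (s≤s (s≤s _)) =
  HubColouring.colouring m n , HubColouring.connected m n

K-hasTPC⇒3≤ : ∀ {m n j} → 2 ≤ m → HasTPC (K m n) j → 3 ≤ j
K-hasTPC⇒3≤ (s≤s (s≤s _)) = hasTPC⇒3≤ {u = a₀} {v = a₁} (λ ()) (λ ())

theorem2 : ∀ (m n : ℕ) → 2 ≤ m → m ≤ n → TPCNumber (K m n) 3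
theorem2 m n 2≤m m≤n =
  K-hasTPC₃ 2≤m (≤-trans 2≤m m≤n) , λ j j<3 → <⇒≱ j<3 ∘ K-hasTPC⇒3≤ 2≤m
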